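{- (1) Let $n$ be a prime. There exist positive integers $a,b,c,d$ with $(4abc-1)d=(a+b)n$ if and only if there exist positive integers $\alpha,\beta,\gamma,\delta$ with $\delta n=(4\alpha\beta\gamma\delta-1)-4\alpha^2\gamma$. (2) Let $n$ be an integer with $n\ge 2$. There exist positive integers $a,b,c,d$ with $(4abc-1)d=an+b$ if and only if there exist positive integers $\alpha,\beta,\gamma,\delta$ with $n=(4\alpha\beta\gamma-1)\delta-4\beta^2\gamma$. -}

module Defs where

{-# OPTIONS --safe #-}
module Submission where

-- All four implications are explicit changes of variables.  In (2),
-- (a, b, c, d) ↦ (a, b, c, 4bcd − n) and (α, β, γ, δ) ↦ (α, β, γ, αδ − β); the new
-- variable is positive because a(4bcd − n) = d + b and 4βγ(αδ − β) = n + δ.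
-- In (1), the prime n divides 4abc − 1 or d.  If d = en then (4abc − 1)e = a + b,
-- impossible as a + b + e < 4abce; if 4abc − 1 = qn then qd = a + b, and since
-- 4abc = 4ac(a + b) − 4a²c, the tuple (a, d, c, q) solves the second equation.
-- Conversely (α, β, γ, δ) ↦ (α, βδ − α, γ, β), with 4αγ(βδ − α) = δn + 1.

module ℕ-Bounds where
  open import Data.List using (_∷_; [])
  open import Data.Nat
  open import Data.Nat.Properties
  open import Data.Nat.Tactic.RingSolver using (solve)

  sum<4*product : ∀ a b c e .{{_ : NonZero a}} .{{_ : NonZero b}} .{{_ : NonZero c}} .{{_ : NonZero e}} →
                  a + b + e < 4 * a * b * c * e
  sum<4*product a b c e = begin-strict
    a + b + e                                      ≤⟨ +-mono-≤ (+-mono-≤ a≤P b≤P) e≤P ⟩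
    a * b * c * e + a * b * c * e + a * b * c * e  ≡⟨ solve (a ∷ b ∷ c ∷ e ∷ []) ⟩
    3 * (a * b * c * e)                            <⟨ *-monoˡ-< (a * b * c * e) {3} {4} (n<1+n 3) ⟩
    4 * (a * b * c * e)                            ≡⟨ solve (a ∷ b ∷ c ∷ e ∷ []) ⟩
    4 * a * b * c * e                              ∎
    where
    open ≤-Reasoning
    instance
      _ = m*n≢0 a b
      _ = m*n≢0 (a * b) c
      _ = m*n≢0 (a * b * c) e
    ab≤P : a * b ≤ a * b * c * e
    ab≤P = ≤-trans (m≤m*n (a * b) c) (m≤m*n (a * b * c) e)
    a≤P : a ≤ a * b * c * e
    a≤P = ≤-trans (m≤m*n a b) ab≤P
    b≤P : b ≤ a * b * c * e
    b≤P = ≤-trans (m≤n*m b a) ab≤P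
    e≤P : e ≤ a * b * c * e
    e≤P = m≤n*m e (a * b * c)

open import Defs
open import Data.Empty using (⊥-elim)
open import Data.Integer
  using (ℤ; +_; _+_; _-_; _*_; _>_; _≥_; _≤_; _<_; 0ℤ; 1ℤ; ∣_∣; +≤+; +<+; nonNegative; >-nonZero)
open import Data.Integer.Divisibility.Signed using (_∣_; divides; ∣ᵤ⇒∣; ∣⇒∣ᵤ)
open import Data.Integer.Properties
  using ( positive⁻¹; +-mono-≤-<; pos-*; *-cancelˡ-<-nonNeg; *-cancelʳ-≡; <⇒≤; ≤-trans; <-irrefl
        ; *-zeroʳ; *-comm; *-assoc; abs-*)
open import Data.Integer.Tactic.RingSolver using (solve)
open import Data.List using (_∷_; [])
open import Data.Nat as ℕ using (ℕ)
import Data.Nat.Divisibility as ℕ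
open import Data.Nat.Primality using (Prime; euclidsLemma; prime⇒nonZero)
open import Data.Product using (_×_; _,_; ∃-syntax)
open import Data.Sum as Sum using (_⊎_; [_,_]′)
open import Function.Base using (_∘_)
open import Function.Bundles using (_⇔_; mk⇔)
open import Relation.Nullary using (¬_)
open import Relation.Binary.PropositionalEquality using (_≡_; sym; cong; subst; module ≡-Reasoning)

Solvable₁ Solvable₁′ Solvable₂ Solvable₂′ : ℤ → Set
Solvable₁ n = ∃[ a ] ∃[ b ] ∃[ c ] ∃[ d ] (a > 0ℤ × b > 0ℤ × c > 0ℤ × d > 0ℤ ×
  (+ 4 * a * b * c - 1ℤ) * d ≡ (a + b) * n)
Solvable₁′ n = ∃[ α ] ∃[ β ] ∃[ γ ] ∃[ δ ] (α > 0ℤ × β > 0ℤ × γ > 0ℤ × δ > 0ℤ ×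
  δ * n ≡ (+ 4 * α * β * γ * δ - 1ℤ) - + 4 * α * α * γ)
Solvable₂ n = ∃[ a ] ∃[ b ] ∃[ c ] ∃[ d ] (a > 0ℤ × b > 0ℤ × c > 0ℤ × d > 0ℤ ×
  (+ 4 * a * b * c - 1ℤ) * d ≡ a * n + b)
Solvable₂′ n = ∃[ α ] ∃[ β ] ∃[ γ ] ∃[ δ ] (α > 0ℤ × β > 0ℤ × γ > 0ℤ × δ > 0ℤ ×
  n ≡ (+ 4 * α * β * γ - 1ℤ) * δ - + 4 * β * β * γ)

*-pos : ∀ {i j} → i > 0ℤ → j > 0ℤ → i * j > 0ℤ
*-pos (+<+ ℕ.z<s) (+<+ ℕ.z<s) = +<+ ℕ.z<s

*-nonNeg : ∀ {i j} → 0ℤ ≤ i → 0ℤ ≤ j → 0ℤ ≤ i * j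
*-nonNeg {+ m} {+ n} (+≤+ _) (+≤+ _) = subst (0ℤ ≤_) (pos-* m n) (+≤+ ℕ.z≤n)

*-cancelˡ-pos : ∀ {i j} → i > 0ℤ → i * j > 0ℤ → j > 0ℤ
*-cancelˡ-pos {i} {j} i>0 ij>0 =
  *-cancelˡ-<-nonNeg i {{nonNegative (<⇒≤ i>0)}} (subst (_< i * j) (sym (*-zeroʳ i)) ij>0)

*-cancelʳ-pos : ∀ {i j} → j > 0ℤ → i * j > 0ℤ → i > 0ℤ
*-cancelʳ-pos {i} {j} j>0 ij>0 = *-cancelˡ-pos j>0 (subst (_> 0ℤ) (*-comm i j) ij>0)

prime∣*⇒∣⊎∣ : ∀ {p} i j → Prime p → + p ∣ i * j → (+ p ∣ i) ⊎ (+ p ∣ j)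
prime∣*⇒∣⊎∣ i j pr p∣ij = Sum.map ∣ᵤ⇒∣ ∣ᵤ⇒∣
  (euclidsLemma ∣ i ∣ ∣ j ∣ pr (subst (_ ℕ.∣_) (abs-* i j) (∣⇒∣ᵤ p∣ij)))

sum<4*product : ∀ {a b c e} → a > 0ℤ → b > 0ℤ → c > 0ℤ → e > 0ℤ → a + b + e < + 4 * a * b * c * e
sum<4*product {+ a} {+ b} {+ c} {+ e} (+<+ ℕ.z<s) (+<+ ℕ.z<s) (+<+ ℕ.z<s) (+<+ ℕ.z<s) =
  +<+ (ℕ-Bounds.sum<4*product a b c e)

Solvable₁⇒Solvable₁′ : ∀ {n} → n > 0ℤ → (∀ i j → n ∣ i * j → (n ∣ i) ⊎ (n ∣ j)) →
                       Solvable₁ n → Solvable₁′ n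
Solvable₁⇒Solvable₁′ {n} n>0 euclid (a , b , c , d , a>0 , b>0 , c>0 , d>0 , eq) =
  [ n∣X⇒Solvable₁′ , ⊥-elim ∘ n∤d ]′ (euclid X d (divides (a + b) eq))
  where
  open ≡-Reasoning
  instance _ = >-nonZero n>0
  X = + 4 * a * b * c - 1ℤ

  n∣X⇒Solvable₁′ : n ∣ X → Solvable₁′ n
  n∣X⇒Solvable₁′ (divides q X≡qn) = a , d , c , q , a>0 , d>0 , c>0 , q>0 , qn≡
    where
    qd≡a+b : q * d ≡ a + b
    qd≡a+b = *-cancelʳ-≡ (q * d) (a + b) n (begin
      q * d * n    ≡⟨ solve (q ∷ d ∷ n ∷ []) ⟩
      q * n * d    ≡⟨ cong (_* d) X≡qn ⟨
      X * d        ≡⟨ eq ⟩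
      (a + b) * n  ∎)
    q>0 : q > 0ℤ
    q>0 = *-cancelʳ-pos d>0 (subst (_> 0ℤ) (sym qd≡a+b) (+-mono-≤-< (<⇒≤ a>0) b>0))
    qn≡ : q * n ≡ (+ 4 * a * d * c * q - 1ℤ) - + 4 * a * a * c
    qn≡ = begin
      q * n                                          ≡⟨ X≡qn ⟨
      + 4 * a * b * c - 1ℤ                           ≡⟨ solve (a ∷ b ∷ c ∷ []) ⟩
      + 4 * a * c * (a + b) - 1ℤ - + 4 * a * a * c   ≡⟨ cong (λ t → + 4 * a * c * t - 1ℤ - + 4 * a * a * c) qd≡a+b ⟨
      + 4 * a * c * (q * d) - 1ℤ - + 4 * a * a * c   ≡⟨ solve (a ∷ c ∷ d ∷ q ∷ []) ⟩
      + 4 * a * d * c * q - 1ℤ - + 4 * a * a * c     ∎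

  n∤d : ¬ (n ∣ d)
  n∤d (divides e d≡en) = <-irrefl a+b+e≡4abce (sum<4*product a>0 b>0 c>0 e>0)
    where
    Xe≡a+b : X * e ≡ a + b
    Xe≡a+b = *-cancelʳ-≡ (X * e) (a + b) n (begin
      X * e * n    ≡⟨ *-assoc X e n ⟩
      X * (e * n)  ≡⟨ cong (X *_) d≡en ⟨
      X * d        ≡⟨ eq ⟩
      (a + b) * n  ∎)
    e>0 : e > 0ℤ
    e>0 = *-cancelʳ-pos n>0 (subst (_> 0ℤ) d≡en d>0)
    a+b+e≡4abce : a + b + e ≡ + 4 * a * b * c * e
    a+b+e≡4abce = begin
      a + b + e                             ≡⟨ cong (_+ e) Xe≡a+b ⟨
      (+ 4 * a * b * c - 1ℤ) * e + e        ≡⟨ solve (a ∷ b ∷ c ∷ e ∷ []) ⟩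
      + 4 * a * b * c * e                   ∎

Solvable₁′⇒Solvable₁ : ∀ {n} → 0ℤ ≤ n → Solvable₁′ n → Solvable₁ n
Solvable₁′⇒Solvable₁ {n} n≥0 (α , β , γ , δ , α>0 , β>0 , γ>0 , δ>0 , eq) =
  α , β * δ - α , γ , β , α>0 , βδ-α>0 , γ>0 , β>0 , eq′
  where
  open ≡-Reasoning
  4αγ[βδ-α]≡δn+1 : + 4 * α * γ * (β * δ - α) ≡ δ * n + 1ℤ
  4αγ[βδ-α]≡δn+1 = begin
    + 4 * α * γ * (β * δ - α)                         ≡⟨ solve (α ∷ β ∷ γ ∷ δ ∷ []) ⟩
    (+ 4 * α * β * γ * δ - 1ℤ) - + 4 * α * α * γ + 1ℤ  ≡⟨ cong (_+ 1ℤ) eq ⟨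
    δ * n + 1ℤ                                        ∎
  βδ-α>0 : β * δ - α > 0ℤ
  βδ-α>0 = *-cancelˡ-pos (*-pos (*-pos (positive⁻¹ (+ 4)) α>0) γ>0)
          (subst (_> 0ℤ) (sym 4αγ[βδ-α]≡δn+1) (+-mono-≤-< (*-nonNeg (<⇒≤ δ>0) n≥0) (positive⁻¹ 1ℤ)))
  eq′ : (+ 4 * α * (β * δ - α) * γ - 1ℤ) * β ≡ (α + (β * δ - α)) * n
  eq′ = begin
    (+ 4 * α * (β * δ - α) * γ - 1ℤ) * β               ≡⟨ solve (α ∷ β ∷ γ ∷ δ ∷ []) ⟩
    ((+ 4 * α * β * γ * δ - 1ℤ) - + 4 * α * α * γ) * β  ≡⟨ cong (_* β) eq ⟨
    δ * n * β                                          ≡⟨ solve (α ∷ β ∷ δ ∷ n ∷ []) ⟩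
    (α + (β * δ - α)) * n                              ∎

Solvable₂⇒Solvable₂′ : ∀ {n} → Solvable₂ n → Solvable₂′ n
Solvable₂⇒Solvable₂′ {n} (a , b , c , d , a>0 , b>0 , c>0 , d>0 , eq) =
  a , b , c , + 4 * b * c * d - n , a>0 , b>0 , c>0 , 4bcd-n>0 , n≡
  where
  open ≡-Reasoning
  a[4bcd-n]≡d+b : a * (+ 4 * b * c * d - n) ≡ d + b
  a[4bcd-n]≡d+b = begin
    a * (+ 4 * b * c * d - n)                ≡⟨ solve (a ∷ b ∷ c ∷ d ∷ n ∷ []) ⟩
    (+ 4 * a * b * c - 1ℤ) * d + d - a * n   ≡⟨ cong (λ t → t + d - a * n) eq ⟩
    a * n + b + d - a * n                    ≡⟨ solve (a ∷ b ∷ d ∷ n ∷ []) ⟩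
    d + b                                    ∎
  4bcd-n>0 : + 4 * b * c * d - n > 0ℤ
  4bcd-n>0 = *-cancelˡ-pos a>0 (subst (_> 0ℤ) (sym a[4bcd-n]≡d+b) (+-mono-≤-< (<⇒≤ d>0) b>0))
  n≡ : n ≡ (+ 4 * a * b * c - 1ℤ) * (+ 4 * b * c * d - n) - + 4 * b * b * c
  n≡ = sym (begin
    (+ 4 * a * b * c - 1ℤ) * (+ 4 * b * c * d - n) - + 4 * b * b * c  ≡⟨ solve (a ∷ b ∷ c ∷ d ∷ n ∷ []) ⟩
    n + + 4 * b * c * ((+ 4 * a * b * c - 1ℤ) * d - (a * n + b))     ≡⟨ cong (λ t → n + + 4 * b * c * (t - (a * n + b))) eq ⟩
    n + + 4 * b * c * ((a * n + b) - (a * n + b))                    ≡⟨ solve (a ∷ b ∷ c ∷ n ∷ []) ⟩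
    n                                                                ∎)

Solvable₂′⇒Solvable₂ : ∀ {n} → 0ℤ ≤ n → Solvable₂′ n → Solvable₂ n
Solvable₂′⇒Solvable₂ {n} n≥0 (α , β , γ , δ , α>0 , β>0 , γ>0 , δ>0 , eq) =
  α , β , γ , α * δ - β , α>0 , β>0 , γ>0 , αδ-β>0 , eq′
  where
  open ≡-Reasoning
  4βγ[αδ-β]≡n+δ : + 4 * β * γ * (α * δ - β) ≡ n + δ
  4βγ[αδ-β]≡n+δ = begin
    + 4 * β * γ * (α * δ - β)                          ≡⟨ solve (α ∷ β ∷ γ ∷ δ ∷ []) ⟩
    (+ 4 * α * β * γ - 1ℤ) * δ - + 4 * β * β * γ + δ   ≡⟨ cong (_+ δ) eq ⟨
    n + δ                                              ∎
  αδ-β>0 : α * δ - β > 0ℤ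
  αδ-β>0 = *-cancelˡ-pos (*-pos (*-pos (positive⁻¹ (+ 4)) β>0) γ>0)
          (subst (_> 0ℤ) (sym 4βγ[αδ-β]≡n+δ) (+-mono-≤-< n≥0 δ>0))
  eq′ : (+ 4 * α * β * γ - 1ℤ) * (α * δ - β) ≡ α * n + β
  eq′ = begin
    (+ 4 * α * β * γ - 1ℤ) * (α * δ - β)                   ≡⟨ solve (α ∷ β ∷ γ ∷ δ ∷ []) ⟩
    α * ((+ 4 * α * β * γ - 1ℤ) * δ - + 4 * β * β * γ) + β  ≡⟨ cong (λ t → α * t + β) eq ⟨
    α * n + β                                              ∎

lemma2p2 : ((n : ℕ) → Prime n →
    ((∃[ a ] ∃[ b ] ∃[ c ] ∃[ d ] (a > 0ℤ × b > 0ℤ × c > 0ℤ × d > 0ℤ ×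
    (+ 4 * a * b * c - 1ℤ) * d ≡ (a + b) * + n))
    ⇔
    (∃[ α ] ∃[ β ] ∃[ γ ] ∃[ δ ] (α > 0ℤ × β > 0ℤ × γ > 0ℤ × δ > 0ℤ ×
    δ * + n ≡ (+ 4 * α * β * γ * δ - 1ℤ) - + 4 * α * α * γ))))
    ×
    ((n : ℤ) → n Data.Integer.≥ + 2 →
    ((∃[ a ] ∃[ b ] ∃[ c ] ∃[ d ] (a > 0ℤ × b > 0ℤ × c > 0ℤ × d > 0ℤ ×
    (+ 4 * a * b * c - 1ℤ) * d ≡ a * n + b))
    ⇔
    (∃[ α ] ∃[ β ] ∃[ γ ] ∃[ δ ] (α > 0ℤ × β > 0ℤ × γ > 0ℤ × δ > 0ℤ ×
    n ≡ (+ 4 * α * β * γ - 1ℤ) * δ - + 4 * β * β * γ))))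
lemma2p2 = part₁ , part₂
  where
  part₁ : (p : ℕ) → Prime p → Solvable₁ (+ p) ⇔ Solvable₁′ (+ p)
  part₁ p pr = mk⇔ (Solvable₁⇒Solvable₁′ p>0 (λ i j → prime∣*⇒∣⊎∣ i j pr))
                   (Solvable₁′⇒Solvable₁ (+≤+ ℕ.z≤n))
    where
    p>0 : + p > 0ℤ
    p>0 = +<+ (ℕ.>-nonZero⁻¹ p {{prime⇒nonZero pr}})

  part₂ : (n : ℤ) → n ≥ + 2 → Solvable₂ n ⇔ Solvable₂′ n
  part₂ n n≥2 = mk⇔ Solvable₂⇒Solvable₂′ (Solvable₂′⇒Solvable₂ (≤-trans (+≤+ ℕ.z≤n) n≥2))
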